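{- Let $\mathcal{U}=\{u_i\leftrightarrow U_i\}_{i<m}$ be a set of co-eNDT extension axioms. For each co-$\mathsf{eLNDT}$ proof $\pi$ over $\mathcal{U}$ of a sequent $\Gamma\to\Delta$ of co-eNDT formulas, there is an $\mathsf{eLNDT}$ proof $\bar\pi$ over $\bar{\mathcal{U}}$ of $\bar\Delta\to\bar\Gamma$ of size polynomial in $|\pi|$.
   Context: Propositional variables $p,q,\dots$; $ApB$ means "if $p$ then $B$ else $A$"; $p$ is identified with $0p1$. eNDT formulas: $A::=0\mid1\mid ApB\mid A\lor B\mid e$ with extension variables $e$. co-eNDT formulas: $U,V::=0\mid1\mid UpV\mid U\land V\mid u_i$ with a fresh set of extension variables $u_0,u_1,\dots$; in a set of co-eNDT extension axioms $\{u_i\leftrightarrow U_i\}_{i<m}$ each $U_i$ mentions only $u_0,\dots,u_{i-1}$. Negation: for each $u_j$ let $\bar u_j$ be a fresh eNDT extension variable; define $\bar0=1$, $\bar1=0$, $\overline{UpV}=\bar U\,p\,\bar V$, $\overline{U\land V}=\bar U\lor\bar V$. For a list $\Gamma$, $\bar\Gamma=\{\bar U:U\in\Gamma\}$ (as a list), and $\bar{\mathcal{U}}=\{\bar u_i\leftrightarrow\bar U_i\}_{i<m}$. $\mathsf{LNDT}$ rules: identity $A\to A$; cut; exchange, weakening, contraction on both sides; axiom $0\to$; from $\Gamma\to\Delta$ infer $\Gamma,1\to\Delta$ and $\Gamma\to\Delta,0$; axiom $\to1$; $\lor$-left (from $\Gamma,A\to\Delta$ and $\Gamma,B\to\Delta$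 infer $\Gamma,A\lor B\to\Delta$); $\lor$-right (from $\Gamma\to\Delta,A,B$ infer $\Gamma\to\Delta,A\lor B$); $p$-left (from $\Gamma,A\to\Delta,p$ and $\Gamma,p,B\to\Delta$ infer $\Gamma,ApB\to\Delta$); $p$-right (from $\Gamma\to\Delta,A,p$ and $\Gamma,p\to\Delta,B$ infer $\Gamma\to\Delta,ApB$). An $\mathsf{eLNDT}$ proof over a set of eNDT extension axioms is a finite list of sequents each a hypothesis $e\to E$, $E\to e$ or derived from earlier ones by these rules. co-$\mathsf{eLNDT}$ is defined identically over co-eNDT formulas and co-eNDT extension axioms but with the $\lor$ rules replaced by $\land$-left (from $\Gamma,U,V\to\Delta$ infer $\Gamma,U\land V\to\Delta$) and $\land$-right (from $\Gamma\to\Delta,U$ and $\Gamma\to\Delta,V$ infer $\Gamma\to\Delta,U\land V$). Size = number of symbols. -}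

module Defs where

open import Data.Nat using (ℕ; zero; suc; _+_; _<_)
open import Data.List using (List; []; _∷_; _++_; [_]; map)
open import Data.Nat.ListAction using (sum)
open import Data.List.Membership.Propositional using (_∈_)
open import Data.List.Relation.Unary.All using (All)
open import Data.Product using (Σ; _×_; _,_)
open import Data.Sum using (_⊎_)
open import Data.Unit using (⊤)
open import Relation.Binary.PropositionalEquality using (_≡_)

-- Formulas.  Propositional variables and extension variables are ℕ.
-- The atom p is identified with the formula  0 p 1  (see `var`).

data EF : Set where
  e0 e1 : EF
  eite  : EF → ℕ → EF → EF     -- eite A p B  =  "if p then B else A"
  _∨_   : EF → EF → EF
  eext  : ℕ → EF

data CF : Set where
  c0 c1 : CF
  cite  : CF → ℕ → CF → CF
  _∧_   : CF → CF → CF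
  cext  : ℕ → CF

evar : ℕ → EF
evar p = eite e0 p e1

cvar : ℕ → CF
cvar p = cite c0 p c1

esize : EF → ℕ
esize e0 = 1
esize e1 = 1
esize (eite A p B) = 2 + esize A + esize B
esize (A ∨ B) = 1 + esize A + esize B
esize (eext e) = 1

csize : CF → ℕ
csize c0 = 1
csize c1 = 1
csize (cite U p V) = 2 + csize U + csize V
csize (U ∧ V) = 1 + csize U + csize V
csize (cext i) = 1

-- Sequents (antecedent and succedent as lists; "Γ , A" is Γ ++ [ A ])

record Seq (F : Set) : Set where
  constructor _⇒_
  field
    ante : List F
    succ : List F

seqSize : {F : Set} → (F → ℕ) → Seq F → ℕ
seqSize sz (Γ ⇒ Δ) = 1 + sum (map sz Γ) + sum (map sz Δ)

module Common (F : Set) (𝟘 𝟙 : F) (ite : F → ℕ → F → F) where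

  atom : ℕ → F
  atom p = ite 𝟘 p 𝟙

  data Struct : List (Seq F) → Seq F → Set where
    identity : ∀ A → Struct [] ([ A ] ⇒ [ A ])
    cut : ∀ Γ Δ A →
      Struct ((Γ ⇒ (Δ ++ [ A ])) ∷ ((Γ ++ [ A ]) ⇒ Δ) ∷ []) (Γ ⇒ Δ)
    exchL : ∀ Γ Γ' Δ A B →
      Struct [ (Γ ++ A ∷ B ∷ Γ') ⇒ Δ ] ((Γ ++ B ∷ A ∷ Γ') ⇒ Δ)
    exchR : ∀ Γ Δ Δ' A B →
      Struct [ Γ ⇒ (Δ ++ A ∷ B ∷ Δ') ] (Γ ⇒ (Δ ++ B ∷ A ∷ Δ'))
    weakL : ∀ Γ Δ A → Struct [ Γ ⇒ Δ ] ((Γ ++ [ A ]) ⇒ Δ)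
    weakR : ∀ Γ Δ A → Struct [ Γ ⇒ Δ ] (Γ ⇒ (Δ ++ [ A ]))
    contrL : ∀ Γ Δ A → Struct [ (Γ ++ A ∷ A ∷ []) ⇒ Δ ] ((Γ ++ [ A ]) ⇒ Δ)
    contrR : ∀ Γ Δ A → Struct [ Γ ⇒ (Δ ++ A ∷ A ∷ []) ] (Γ ⇒ (Δ ++ [ A ]))
    zeroL : Struct [] ([ 𝟘 ] ⇒ [])
    oneL  : ∀ Γ Δ → Struct [ Γ ⇒ Δ ] ((Γ ++ [ 𝟙 ]) ⇒ Δ)
    zeroR : ∀ Γ Δ → Struct [ Γ ⇒ Δ ] (Γ ⇒ (Δ ++ [ 𝟘 ]))
    oneR  : Struct [] ([] ⇒ [ 𝟙 ])
    pL : ∀ Γ Δ A p B →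
      Struct (((Γ ++ [ A ]) ⇒ (Δ ++ [ atom p ])) ∷
              ((Γ ++ atom p ∷ B ∷ []) ⇒ Δ) ∷ [])
             ((Γ ++ [ ite A p B ]) ⇒ Δ)
    pR : ∀ Γ Δ A p B →
      Struct ((Γ ⇒ (Δ ++ A ∷ atom p ∷ [])) ∷
              ((Γ ++ [ atom p ]) ⇒ (Δ ++ [ B ])) ∷ [])
             (Γ ⇒ (Δ ++ [ ite A p B ]))

  -- A proof is a finite list of sequents, each a hypothesis or derived
  -- from earlier ones.  Lists are stored NEWEST FIRST: the head is the
  -- last line of the proof, i.e. its conclusion.
  module Proofs (Rule : List (Seq F) → Seq F → Set)
                (Hyp : Seq F → Set) where

    Justified : List (Seq F) → Seq F → Set
    Justified earlier s =
      Hyp s ⊎ Σ (List (Seq F)) (λ prems → Rule prems s × All (_∈ earlier) prems)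

    Valid : List (Seq F) → Set
    Valid [] = ⊤
    Valid (s ∷ π) = Justified π s × Valid π

    ProofOf : List (Seq F) → Seq F → Set
    ProofOf [] S = Data.Empty.⊥ where import Data.Empty
    ProofOf (s ∷ π) S = Valid (s ∷ π) × s ≡ S

module E = Common EF e0 e1 eite

data ERule : List (Seq EF) → Seq EF → Set where
  struct : ∀ {ps s} → E.Struct ps s → ERule ps s
  orL : ∀ Γ Δ A B →
    ERule (((Γ ++ [ A ]) ⇒ Δ) ∷ ((Γ ++ [ B ]) ⇒ Δ) ∷ []) ((Γ ++ [ A ∨ B ]) ⇒ Δ)
  orR : ∀ Γ Δ A B →
    ERule [ Γ ⇒ (Δ ++ A ∷ B ∷ []) ] (Γ ⇒ (Δ ++ [ A ∨ B ]))

EAxioms : Set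
EAxioms = List (ℕ × EF)

data EHyp (ax : EAxioms) : Seq EF → Set where
  hypL : ∀ {e E} → (e , E) ∈ ax → EHyp ax ([ eext e ] ⇒ [ E ])
  hypR : ∀ {e E} → (e , E) ∈ ax → EHyp ax ([ E ] ⇒ [ eext e ])

EProofOf : EAxioms → List (Seq EF) → Seq EF → Set
EProofOf ax = E.Proofs.ProofOf ERule (EHyp ax)

eproofSize : List (Seq EF) → ℕ
eproofSize π = sum (map (seqSize esize) π)

module C = Common CF c0 c1 cite

data CRule : List (Seq CF) → Seq CF → Set where
  struct : ∀ {ps s} → C.Struct ps s → CRule ps s
  andL : ∀ Γ Δ U V →
    CRule [ (Γ ++ U ∷ V ∷ []) ⇒ Δ ] ((Γ ++ [ U ∧ V ]) ⇒ Δ)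
  andR : ∀ Γ Δ U V →
    CRule ((Γ ⇒ (Δ ++ [ U ])) ∷ (Γ ⇒ (Δ ++ [ V ])) ∷ []) (Γ ⇒ (Δ ++ [ U ∧ V ]))

-- co-eNDT extension axioms {u_i ↔ U_i}_{i<m}: the list [U_0 , … , U_{m-1}]
CAxioms : Set
CAxioms = List CF

Below : ℕ → CF → Set
Below i c0 = ⊤
Below i c1 = ⊤
Below i (cite U p V) = Below i U × Below i V
Below i (U ∧ V) = Below i U × Below i V
Below i (cext j) = j < i

WFfrom : ℕ → CAxioms → Set
WFfrom i [] = ⊤
WFfrom i (U ∷ Us) = Below i U × WFfrom (suc i) Us

WellFormedC : CAxioms → Set
WellFormedC = WFfrom 0

indexedFrom : {A : Set} → ℕ → List A → List (ℕ × A)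
indexedFrom i [] = []
indexedFrom i (x ∷ xs) = (i , x) ∷ indexedFrom (suc i) xs

indexed : {A : Set} → List A → List (ℕ × A)
indexed = indexedFrom 0

data CHyp (ax : CAxioms) : Seq CF → Set where
  hypL : ∀ {i U} → (i , U) ∈ indexed ax → CHyp ax ([ cext i ] ⇒ [ U ])
  hypR : ∀ {i U} → (i , U) ∈ indexed ax → CHyp ax ([ U ] ⇒ [ cext i ])

CProofOf : CAxioms → List (Seq CF) → Seq CF → Set
CProofOf ax = C.Proofs.ProofOf CRule (CHyp ax)

cproofSize : List (Seq CF) → ℕ
cproofSize π = sum (map (seqSize csize) π)

-- Negation.  The eNDT extension variable ū_j is represented as eext j.

neg : CF → EF
neg c0 = e1
neg c1 = e0
neg (cite U p V) = eite (neg U) p (neg V)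
neg (U ∧ V) = neg U ∨ neg V
neg (cext j) = eext j

negList : List CF → List EF
negList = map neg

negAxioms : CAxioms → EAxioms
negAxioms ax = indexed (map neg ax)

-- Negation preserves formula size and turns every co-LNDT rule except p-left and p-right into
-- the LNDT rule obtained by swapping antecedent and succedent (∧ ↦ ∨, 0 ↦ 1, u_i ↦ ū_i), so
-- those lines of π translate line by line. The p-rules do not: the negation of the atom p = 0 p 1
-- is p̄ = 1 p 0, not p. But p̄ behaves as the negation of p: the sequents ⇒ p, p̄ and p, p̄ ⇒ have
-- constant-size proofs, and a cut against them, weakened to the context, moves p̄ on one side to p
-- on the other. Each line of π thus becomes O(|π|) lines of size O(|π|), a proof of size O(|π|³).

module Submission where

open import Defs
open import Data.Bool using (T)
open import Data.Nat using (ℕ; suc; _+_; _*_; _^_; _≤_; _≤ᵇ_; z≤n; s≤s)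
open import Data.Nat.Properties
open import Data.Nat.ListAction using (sum)
open import Data.Nat.ListAction.Properties using (sum-++; sum-↭)
open import Data.Nat.Solver using (module +-*-Solver)
open import Data.List using (List; []; _∷_; _++_; [_]; map; length)
open import Data.List.Properties using (map-++; ++-assoc; ++-identityʳ)
open import Data.List.Membership.Propositional using (_∈_)
open import Data.List.Membership.Propositional.Properties using (∈-map⁺)
open import Data.List.Relation.Binary.Subset.Propositional using (_⊆_)
open import Data.List.Relation.Binary.Subset.Propositional.Properties
  using (xs⊆ys++xs; ∈-∷⁺ʳ) renaming (map⁺ to ⊆-map⁺)
open import Data.List.Relation.Binary.Permutation.Propositional
  using (_↭_; ↭-refl; ↭-swap; ↭-trans; ↭-reflexive)
open import Data.List.Relation.Binary.Permutation.Propositional.Properties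
  using (++⁺ˡ) renaming (map⁺ to ↭-map⁺; ++-comm to ↭-++-comm)
open import Data.List.Relation.Unary.All as All using (All; []; _∷_)
open import Data.List.Relation.Unary.Any using (here; there)
open import Data.Product using (Σ; _×_; _,_)
open import Data.Sum using (inj₁; inj₂)
open import Data.Unit using (⊤; tt)
open import Relation.Binary.PropositionalEquality hiding ([_])
open +-*-Solver using (solve; _:+_; _:*_; _:^_; _:=_; con)

Sq : Set
Sq = Seq EF

size : Sq → ℕ
size = seqSize esize

∑size : List EF → ℕ
∑size Θ = sum (map esize Θ)

∑size-++ : ∀ Θ Θ' → ∑size (Θ ++ Θ') ≡ ∑size Θ + ∑size Θ'
∑size-++ Θ Θ' = trans (cong sum (map-++ esize Θ Θ')) (sum-++ (map esize Θ) (map esize Θ'))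

∑size-↭ : ∀ {Θ Θ'} → Θ ↭ Θ' → ∑size Θ ≡ ∑size Θ'
∑size-↭ Θ↭Θ' = sum-↭ (↭-map⁺ esize Θ↭Θ')

∑size-prefix : ∀ Θ W → ∑size Θ ≤ ∑size (Θ ++ W)
∑size-prefix Θ W = subst (∑size Θ ≤_) (sym (∑size-++ Θ W)) (m≤m+n (∑size Θ) (∑size W))

∑size-infix : ∀ Z Y S → ∑size (Z ++ S) ≤ ∑size (Z ++ Y ++ S)
∑size-infix []      Y S = subst (∑size S ≤_) (sym (∑size-++ Y S)) (m≤n+m (∑size S) (∑size Y))
∑size-infix (A ∷ Z) Y S = +-monoʳ-≤ (esize A) (∑size-infix Z Y S)

1≤esize : ∀ A → 1 ≤ esize A
1≤esize e0           = s≤s z≤n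
1≤esize e1           = s≤s z≤n
1≤esize (eite _ _ _) = s≤s z≤n
1≤esize (_ ∨ _)      = s≤s z≤n
1≤esize (eext _)     = s≤s z≤n

length≤∑size : ∀ Θ → length Θ ≤ ∑size Θ
length≤∑size []      = z≤n
length≤∑size (A ∷ Θ) = +-mono-≤ (1≤esize A) (length≤∑size Θ)

size-++ˡ : ∀ Γ Δ W → size ((Γ ++ W) ⇒ Δ) ≡ size (Γ ⇒ Δ) + ∑size W
size-++ˡ Γ Δ W =
  trans (cong (λ g → 1 + g + ∑size Δ) (∑size-++ Γ W))
        (solve 3 (λ g w d → con 1 :+ (g :+ w) :+ d := con 1 :+ g :+ d :+ w) refl (∑size Γ) (∑size W) (∑size Δ))

size-++ʳ : ∀ Γ Δ W → size (Γ ⇒ (Δ ++ W)) ≡ size (Γ ⇒ Δ) + ∑size W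
size-++ʳ Γ Δ W = trans (cong (1 + ∑size Γ +_) (∑size-++ Δ W)) (sym (+-assoc (1 + ∑size Γ) (∑size Δ) (∑size W)))

length-ante≤size : ∀ Γ Δ → length Γ ≤ size (Γ ⇒ Δ)
length-ante≤size Γ Δ = ≤-trans (length≤∑size Γ) (≤-trans (n≤1+n _) (m≤m+n (1 + ∑size Γ) (∑size Δ)))

length-succ≤size : ∀ Γ Δ → length Δ ≤ size (Γ ⇒ Δ)
length-succ≤size Γ Δ = ≤-trans (length≤∑size Δ) (m≤n+m (∑size Δ) (1 + ∑size Γ))

eproofSize-++ : ∀ β β' → eproofSize (β ++ β') ≡ eproofSize β + eproofSize β'
eproofSize-++ β β' = trans (cong sum (map-++ size β β')) (sum-++ (map size β) (map size β'))

-- Weakening and exchange are the same rule on either side of a sequent.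
data Side : Set where
  left right : Side

put : Side → List EF → List EF → Sq
put left  Θ Π = Θ ⇒ Π
put right Θ Π = Π ⇒ Θ

size-put-↭ : ∀ σ Π {Θ Θ'} → Θ ↭ Θ' → size (put σ Θ Π) ≡ size (put σ Θ' Π)
size-put-↭ left  Π Θ↭Θ' = cong (λ n → 1 + n + ∑size Π) (∑size-↭ Θ↭Θ')
size-put-↭ right Π Θ↭Θ' = cong (1 + ∑size Π +_) (∑size-↭ Θ↭Θ')

size-put-mono : ∀ σ Π Θ Θ' → ∑size Θ ≤ ∑size Θ' → size (put σ Θ Π) ≤ size (put σ Θ' Π)
size-put-mono left  Π Θ Θ' Θ≤Θ' = +-monoˡ-≤ (∑size Π) (+-monoʳ-≤ 1 Θ≤Θ')
size-put-mono right Π Θ Θ' Θ≤Θ' = +-monoʳ-≤ (1 + ∑size Π) Θ≤Θ'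

weakening : ∀ σ Θ Π A → ERule [ put σ Θ Π ] (put σ (Θ ++ [ A ]) Π)
weakening left  Θ Π A = struct (E.weakL Θ Π A)
weakening right Θ Π A = struct (E.weakR Π Θ A)

exchange : ∀ σ Z S Π A A' → ERule [ put σ (Z ++ A ∷ A' ∷ S) Π ] (put σ (Z ++ A' ∷ A ∷ S) Π)
exchange left  Z S Π A A' = struct (E.exchL Z S Π A A')
exchange right Z S Π A A' = struct (E.exchR Π Z S A A')

-- p̄ = 1 p 0 = neg (cvar p)
coatom : ℕ → EF
coatom p = eite e1 p e0


module Extensions (ax : EAxioms) (B : ℕ) where
  open E.Proofs ERule (EHyp ax) public

  ValidOver : List Sq → List Sq → Set
  ValidOver E []      = ⊤
  ValidOver E (S ∷ β) = Justified (β ++ E) S × ValidOver E β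

  ValidOver-++ : ∀ {E} β β' → ValidOver (β' ++ E) β → ValidOver E β' → ValidOver E (β ++ β')
  ValidOver-++     []      β' _       v' = v'
  ValidOver-++ {E} (S ∷ β) β' (j , v) v' =
    subst (λ Φ → Justified Φ S) (sym (++-assoc β β' E)) j , ValidOver-++ β β' v v'

  ValidOver⇒Valid : ∀ {E} β → ValidOver E β → Valid E → Valid (β ++ E)
  ValidOver⇒Valid []      _       vE = vE
  ValidOver⇒Valid (S ∷ β) (j , v) vE = j , ValidOver⇒Valid β v vE

  record Extension (E : List Sq) (n : ℕ) (P : List Sq → Set) : Set where
    constructor extension
    field
      new   : List Sq
      valid : ValidOver E new
      goal  : P (new ++ E)
      cost  : eproofSize new ≤ n * B

  Derives : List Sq → ℕ → Sq → Set
  Derives E n S = Extension E n (S ∈_)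

  pure : ∀ {E P} → P E → Extension E 0 P
  pure p = extension [] tt p z≤n

  relax : ∀ {E m n P} → m ≤ n → Extension E m P → Extension E n P
  relax m≤n (extension new valid goal cost) = extension new valid goal (≤-trans cost (*-monoˡ-≤ B m≤n))

  infixl 1 _>>=_
  _>>=_ : ∀ {E m n P Q} → Extension E m P → (∀ {E'} → E ⊆ E' → P E' → Extension E' n Q) →
          Extension E (m + n) Q
  _>>=_ {E} {m} {n} {Q = Q} (extension β v p c) k =
    let extension β' v' q c' = k (xs⊆ys++xs E β) p in
    extension (β' ++ β) (ValidOver-++ β' β v' v) (subst Q (sym (++-assoc β' β E)) q) (begin
      eproofSize (β' ++ β)          ≡⟨ eproofSize-++ β' β ⟩
      eproofSize β' + eproofSize β  ≤⟨ +-mono-≤ c' c ⟩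
      n * B + m * B                 ≡⟨ +-comm (n * B) (m * B) ⟩
      m * B + n * B                 ≡⟨ *-distribʳ-+ B m n ⟨
      (m + n) * B                   ∎)
    where open ≤-Reasoning

  infer : ∀ {E ps S} → ERule ps S → size S ≤ B → All (_∈ E) ps → Derives E 1 S
  infer r S≤B prems = extension [ _ ] (inj₂ (_ , r , prems) , tt) (here refl) (+-monoˡ-≤ 0 S≤B)

  assume : ∀ {E S} → EHyp ax S → size S ≤ B → Derives E 1 S
  assume h S≤B = extension [ _ ] (inj₁ h , tt) (here refl) (+-monoˡ-≤ 0 S≤B)

  module _ (σ : Side) (Π : List EF) where

    bubble : ∀ {E} Z S A → put σ (Z ++ S ++ [ A ]) Π ∈ E → size (put σ (Z ++ A ∷ S) Π) ≤ B →
             Derives E (length S) (put σ (Z ++ A ∷ S) Π)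
    bubble     Z []       A m _    = pure m
    bubble {E} Z (A' ∷ S) A m fits =
      relax (≤-reflexive (+-comm (length S) 1)) (
        bubble (Z ++ [ A' ]) S A (subst (λ Θ → put σ Θ Π ∈ E) (sym (++-assoc Z [ A' ] (S ++ [ A ]))) m) fits'
          >>= λ _ m' →
        infer (exchange σ Z S Π A' A) fits (subst (λ Θ → put σ Θ Π ∈ _) (++-assoc Z [ A' ] (A ∷ S)) m' ∷ []))
      where
        perm : (Z ++ [ A' ]) ++ A ∷ S ↭ Z ++ A ∷ A' ∷ S
        perm = ↭-trans (↭-reflexive (++-assoc Z [ A' ] (A ∷ S))) (++⁺ˡ Z (↭-swap A' A ↭-refl))
        fits' : size (put σ ((Z ++ [ A' ]) ++ A ∷ S) Π) ≤ B
        fits' = subst (_≤ B) (sym (size-put-↭ σ Π perm)) fits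

    -- The weakening rules only append; each new formula is then exchanged leftwards past S.
    insert : ∀ {E} Z Y S → put σ (Z ++ S) Π ∈ E → size (put σ (Z ++ Y ++ S) Π) ≤ B →
             Derives E (length Y * suc (length S)) (put σ (Z ++ Y ++ S) Π)
    insert     Z []      S m _    = pure m
    insert {E} Z (A ∷ Y) S m fits =
      infer (weakening σ (Z ++ S) Π A) fitsW (m ∷ []) >>= λ _ mW →
      bubble Z S A (subst (λ Θ → put σ Θ Π ∈ _) (++-assoc Z S [ A ]) mW) fitsA >>= λ _ mA →
      subst (λ Θ → Derives _ (length Y * suc (length S)) (put σ Θ Π)) (++-assoc Z [ A ] (Y ++ S))
        (insert (Z ++ [ A ]) Y S (subst (λ Θ → put σ Θ Π ∈ _) (sym (++-assoc Z [ A ] S)) mA) fits')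
      where
        fits' : size (put σ ((Z ++ [ A ]) ++ Y ++ S) Π) ≤ B
        fits' = subst (λ Θ → size (put σ Θ Π) ≤ B) (sym (++-assoc Z [ A ] (Y ++ S))) fits
        fitsA : size (put σ (Z ++ A ∷ S) Π) ≤ B
        fitsA = subst (λ Θ → size (put σ Θ Π) ≤ B) (++-assoc Z [ A ] S)
                  (≤-trans (size-put-mono σ Π _ _ (∑size-infix (Z ++ [ A ]) Y S)) fits')
        perm : (Z ++ S) ++ [ A ] ↭ Z ++ A ∷ S
        perm = ↭-trans (↭-reflexive (++-assoc Z S [ A ])) (++⁺ˡ Z (↭-++-comm S [ A ]))
        fitsW : size (put σ ((Z ++ S) ++ [ A ]) Π) ≤ B
        fitsW = subst (_≤ B) (sym (size-put-↭ σ Π perm)) fitsA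

  ifCost : ℕ
  ifCost = 22 + 8 * B

  module _ (20≤B : 20 ≤ B) where

    private
      small : ∀ k {_ : T (k ≤ᵇ 20)} → k ≤ B
      small k {k≤20} = ≤-trans (≤ᵇ⇒≤ k 20 k≤20) 20≤B

    excludedMiddle : ∀ {E} p → Derives E 7 ([] ⇒ (evar p ∷ coatom p ∷ []))
    excludedMiddle p =
      infer (struct E.oneR) (small _) [] >>= λ _ m₁ →
      infer (struct (E.weakR [] [ e1 ] (evar p))) (small _) (m₁ ∷ []) >>= λ _ m₂ →
      infer (struct (E.exchR [] [] [] e1 (evar p))) (small _) (m₂ ∷ []) >>= λ _ m₃ →
      infer (struct (E.weakR [] (evar p ∷ e1 ∷ []) (evar p))) (small _) (m₃ ∷ []) >>= λ _ m₄ →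
      infer (struct (E.identity (evar p))) (small _) [] >>= λ ⊆₅ m₅ →
      infer (struct (E.zeroR [ evar p ] [ evar p ])) (small _) (m₅ ∷ []) >>= λ ⊆₆ m₆ →
      infer (struct (E.pR [] [ evar p ] e1 p e0)) (small _) (⊆₆ (⊆₅ m₄) ∷ m₆ ∷ [])

    noContradiction : ∀ {E} p → Derives E 8 ((evar p ∷ coatom p ∷ []) ⇒ [])
    noContradiction p =
      infer (struct (E.identity (evar p))) (small _) [] >>= λ _ m₁ →
      infer (struct (E.oneL [ evar p ] [ evar p ])) (small _) (m₁ ∷ []) >>= λ _ m₂ →
      infer (struct E.zeroL) (small _) [] >>= λ ⊆₃ m₃ →
      infer (struct (E.weakL [ e0 ] [] (evar p))) (small _) (m₃ ∷ []) >>= λ ⊆₄ m₄ →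
      infer (struct (E.exchL [] [] [] e0 (evar p))) (small _) (m₄ ∷ []) >>= λ ⊆₅ m₅ →
      infer (struct (E.weakL (evar p ∷ e0 ∷ []) [] (evar p))) (small _) (m₅ ∷ []) >>= λ ⊆₆ m₆ →
      infer (struct (E.exchL [ evar p ] [] [] e0 (evar p))) (small _) (m₆ ∷ []) >>= λ ⊆₇ m₇ →
      infer (struct (E.pL [ evar p ] [] e1 p e0)) (small _) (⊆₇ (⊆₆ (⊆₅ (⊆₄ (⊆₃ m₂)))) ∷ m₇ ∷ [])

    private
      flipCost : ∀ k a b → k ≤ 8 → a ≤ B → b ≤ B → k + (a * 1 + (b * 3 + 2)) ≤ 4 * B + 10
      flipCost k a b k≤8 a≤B b≤B =
        ≤-trans (+-mono-≤ k≤8 (+-mono-≤ (*-monoˡ-≤ 1 a≤B) (+-monoˡ-≤ 2 (*-monoˡ-≤ 3 b≤B))))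
                (≤-reflexive (solve 1 (λ b → con 8 :+ (b :* con 1 :+ (b :* con 3 :+ con 2)) := con 4 :* b :+ con 10) refl B))

      module Room (X Y : List EF) (room : size (X ⇒ Y) + 8 ≤ B) where

        fits : ∀ W V {_ : T (∑size W + ∑size V ≤ᵇ 8)} → size ((X ++ W) ⇒ (Y ++ V)) ≤ B
        fits W V {w+v≤8} = subst (_≤ B) (sym eq) (≤-trans (+-monoʳ-≤ (size (X ⇒ Y)) (≤ᵇ⇒≤ _ 8 w+v≤8)) room)
          where
            eq : size ((X ++ W) ⇒ (Y ++ V)) ≡ size (X ⇒ Y) + (∑size W + ∑size V)
            eq = trans (size-++ʳ (X ++ W) Y V)
                       (trans (cong (_+ ∑size V) (size-++ˡ X Y W)) (+-assoc (size (X ⇒ Y)) (∑size W) (∑size V)))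

        length-ante≤B : length X ≤ B
        length-ante≤B = ≤-trans (length-ante≤size X Y) (≤-trans (m≤m+n _ 8) room)

        length-succ≤B : length Y ≤ B
        length-succ≤B = ≤-trans (length-succ≤size X Y) (≤-trans (m≤m+n _ 8) room)

    -- cut the given sequent against  X ⇒ Y, p, p̄ , weakened from excludedMiddle
    coatomˡ⇒atomʳ : ∀ {E} p X Y → ((X ++ [ coatom p ]) ⇒ Y) ∈ E → size (X ⇒ Y) + 8 ≤ B →
                    Derives E (4 * B + 10) (X ⇒ (Y ++ [ evar p ]))
    coatomˡ⇒atomʳ p X Y given room =
      relax (flipCost 7 (length X) (length Y) (≤ᵇ⇒≤ 7 8 tt) length-ante≤B length-succ≤B) (
        excludedMiddle p >>= λ ⊆₁ m₁ →
        insert left (evar p ∷ coatom p ∷ []) [] X [] m₁ fits₁ >>= λ ⊆₂ m₂ →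
        insert right (X ++ []) [] Y (evar p ∷ coatom p ∷ []) m₂ (fits [] (evar p ∷ coatom p ∷ [])) >>= λ ⊆₃ m₃ →
        infer (weakening right Y (X ++ [ coatom p ]) (evar p)) (fits [ coatom p ] [ evar p ])
              (⊆₃ (⊆₂ (⊆₁ given)) ∷ []) >>= λ ⊆₄ m₄ →
        infer (struct (E.cut X (Y ++ [ evar p ]) (coatom p))) fits₅
              (subst (_∈ _) (cong₂ _⇒_ (++-identityʳ X) (sym (++-assoc Y [ evar p ] [ coatom p ]))) (⊆₄ m₃)
               ∷ m₄ ∷ []))
      where
        open Room X Y room
        fits₁ : size ((X ++ []) ⇒ (evar p ∷ coatom p ∷ [])) ≤ B
        fits₁ = ≤-trans (size-put-mono right (X ++ []) (evar p ∷ coatom p ∷ []) (Y ++ evar p ∷ coatom p ∷ [])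
                                       (∑size-infix [] Y _))
                        (fits [] (evar p ∷ coatom p ∷ []))
        fits₅ : size (X ⇒ (Y ++ [ evar p ])) ≤ B
        fits₅ = subst (λ Γ → size (Γ ⇒ (Y ++ [ evar p ])) ≤ B) (++-identityʳ X) (fits [] [ evar p ])

    -- cut the given sequent against  X, p, p̄ ⇒ Y , weakened from noContradiction
    coatomʳ⇒atomˡ : ∀ {E} p X Y → (X ⇒ (Y ++ [ coatom p ])) ∈ E → size (X ⇒ Y) + 8 ≤ B →
                    Derives E (4 * B + 10) ((X ++ [ evar p ]) ⇒ Y)
    coatomʳ⇒atomˡ p X Y given room =
      relax (flipCost 8 (length Y) (length X) ≤-refl length-succ≤B length-ante≤B) (
        noContradiction p >>= λ ⊆₁ m₁ →
        insert right (evar p ∷ coatom p ∷ []) [] Y [] m₁ fits₁ >>= λ ⊆₂ m₂ →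
        insert left (Y ++ []) [] X (evar p ∷ coatom p ∷ []) m₂ (fits (evar p ∷ coatom p ∷ []) []) >>= λ ⊆₃ m₃ →
        infer (weakening left X (Y ++ [ coatom p ]) (evar p)) (fits [ evar p ] [ coatom p ])
              (⊆₃ (⊆₂ (⊆₁ given)) ∷ []) >>= λ ⊆₄ m₄ →
        infer (struct (E.cut (X ++ [ evar p ]) Y (coatom p))) fits₅
              (m₄ ∷ subst (_∈ _) (cong₂ _⇒_ (sym (++-assoc X [ evar p ] [ coatom p ])) (++-identityʳ Y)) (⊆₄ m₃)
                  ∷ []))
      where
        open Room X Y room
        fits₁ : size ((evar p ∷ coatom p ∷ []) ⇒ (Y ++ [])) ≤ B
        fits₁ = ≤-trans (size-put-mono left (Y ++ []) (evar p ∷ coatom p ∷ []) (X ++ evar p ∷ coatom p ∷ [])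
                                       (∑size-infix [] X _))
                        (fits (evar p ∷ coatom p ∷ []) [])
        fits₅ : size ((X ++ [ evar p ]) ⇒ Y) ≤ B
        fits₅ = subst (λ Δ → size ((X ++ [ evar p ]) ⇒ Δ) ≤ B) (++-identityʳ Y) (fits [ evar p ] [])

    -- the rule p-right with premises in which p̄ stands for p on the other side
    ifʳ : ∀ {E} X Y A p A' →
          ((X ++ [ coatom p ]) ⇒ (Y ++ [ A ])) ∈ E → (X ⇒ (Y ++ coatom p ∷ A' ∷ [])) ∈ E →
          size ((X ++ [ coatom p ]) ⇒ (Y ++ [ A ])) + 8 ≤ B → size (X ⇒ (Y ++ coatom p ∷ A' ∷ [])) + 8 ≤ B →
          size (X ⇒ (Y ++ [ eite A p A' ])) ≤ B → Derives E ifCost (X ⇒ (Y ++ [ eite A p A' ]))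
    ifʳ X Y A p A' m₁ m₂ room₁ room₂ fits =
      relax (≤-reflexive (solve 1 (λ b → (con 4 :* b :+ con 10) :+ (con 1 :+ ((con 4 :* b :+ con 10) :+ con 1))
                                          := con 22 :+ con 8 :* b) refl B)) (
        coatomˡ⇒atomʳ p X (Y ++ [ A ]) m₁ room₁' >>= λ ⊆₁ a →
        infer (exchange right Y [] X (coatom p) A') fitsX (⊆₁ m₂ ∷ []) >>= λ ⊆₂ m₂' →
        coatomʳ⇒atomˡ p X (Y ++ [ A' ]) (subst (λ Δ → (X ⇒ Δ) ∈ _) (sym (++-assoc Y [ A' ] [ coatom p ])) m₂') room₂'
          >>= λ ⊆₃ b →
        infer (struct (E.pR X Y A p A')) fits
              (subst (_∈ _) (cong (X ⇒_) (++-assoc Y [ A ] [ evar p ])) (⊆₃ (⊆₂ a)) ∷ b ∷ []))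
      where
        room₁' : size (X ⇒ (Y ++ [ A ])) + 8 ≤ B
        room₁' = ≤-trans (+-monoˡ-≤ 8 (size-put-mono left (Y ++ [ A ]) X (X ++ [ coatom p ])
                                                     (∑size-prefix X [ coatom p ])))
                         room₁
        room₂' : size (X ⇒ (Y ++ [ A' ])) + 8 ≤ B
        room₂' = ≤-trans (+-monoˡ-≤ 8 (size-put-mono right X (Y ++ [ A' ]) (Y ++ coatom p ∷ A' ∷ [])
                                                     (∑size-infix Y [ coatom p ] [ A' ])))
                         room₂
        fitsX : size (X ⇒ (Y ++ A' ∷ coatom p ∷ [])) ≤ B
        fitsX = subst (_≤ B) (size-put-↭ right X (++⁺ˡ Y (↭-swap (coatom p) A' ↭-refl))) (≤-trans (m≤m+n _ 8) room₂)

    -- the rule p-left with premises in which p̄ stands for p on the other side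
    ifˡ : ∀ {E} X Y A p A' →
          ((X ++ A ∷ coatom p ∷ []) ⇒ Y) ∈ E → ((X ++ [ A' ]) ⇒ (Y ++ [ coatom p ])) ∈ E →
          size ((X ++ A ∷ coatom p ∷ []) ⇒ Y) + 8 ≤ B → size ((X ++ [ A' ]) ⇒ (Y ++ [ coatom p ])) + 8 ≤ B →
          size ((X ++ [ eite A p A' ]) ⇒ Y) ≤ B → Derives E ifCost ((X ++ [ eite A p A' ]) ⇒ Y)
    ifˡ X Y A p A' m₁ m₂ room₁ room₂ fits =
      relax (≤-reflexive (solve 1 (λ b → (con 4 :* b :+ con 10) :+ ((con 4 :* b :+ con 10) :+ (con 1 :+ con 1))
                                          := con 22 :+ con 8 :* b) refl B)) (
        coatomˡ⇒atomʳ p (X ++ [ A ]) Y (subst (λ Γ → (Γ ⇒ Y) ∈ _) (sym assoc₁) m₁) room₁' >>= λ ⊆₁ a →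
        coatomʳ⇒atomˡ p (X ++ [ A' ]) Y (⊆₁ m₂) room₂' >>= λ ⊆₂ b →
        infer (exchange left X [] Y A' (evar p)) fitsX
              (subst (λ Γ → (Γ ⇒ Y) ∈ _) (++-assoc X [ A' ] [ evar p ]) b ∷ []) >>= λ ⊆₃ b' →
        infer (struct (E.pL X Y A p A')) fits (⊆₃ (⊆₂ a) ∷ b' ∷ []))
      where
        assoc₁ : (X ++ [ A ]) ++ [ coatom p ] ≡ X ++ A ∷ coatom p ∷ []
        assoc₁ = ++-assoc X [ A ] [ coatom p ]
        room₁' : size ((X ++ [ A ]) ⇒ Y) + 8 ≤ B
        room₁' = ≤-trans (+-monoˡ-≤ 8 (size-put-mono left Y (X ++ [ A ]) ((X ++ [ A ]) ++ [ coatom p ])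
                                                     (∑size-prefix (X ++ [ A ]) [ coatom p ])))
                         (subst (λ Γ → size (Γ ⇒ Y) + 8 ≤ B) (sym assoc₁) room₁)
        room₂' : size ((X ++ [ A' ]) ⇒ Y) + 8 ≤ B
        room₂' = ≤-trans (+-monoˡ-≤ 8 (size-put-mono right (X ++ [ A' ]) Y (Y ++ [ coatom p ])
                                                     (∑size-prefix Y [ coatom p ])))
                         room₂
        perm : X ++ evar p ∷ A' ∷ [] ↭ (X ++ [ A' ]) ++ [ evar p ]
        perm = ↭-trans (++⁺ˡ X (↭-swap (evar p) A' ↭-refl)) (↭-reflexive (sym (++-assoc X [ A' ] [ evar p ])))
        fitsX : size ((X ++ evar p ∷ A' ∷ []) ⇒ Y) ≤ B
        fitsX = subst (_≤ B) (sym (trans (size-put-↭ left Y perm) (size-++ˡ (X ++ [ A' ]) Y [ evar p ])))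
                      (≤-trans (+-monoʳ-≤ (size ((X ++ [ A' ]) ⇒ Y)) (≤ᵇ⇒≤ 4 8 tt)) room₂')

  -- A proof must end in its conclusion; a line S of τ is re-derived at the end by a cut on 0.
  withConclusion : Sq → List Sq → List Sq
  withConclusion (Γ ⇒ Δ) τ = (Γ ⇒ Δ) ∷ ((Γ ++ [ e0 ]) ⇒ Δ) ∷ (Γ ⇒ (Δ ++ [ e0 ])) ∷ τ

  withConclusion-proof : ∀ {τ} S → Valid τ → S ∈ τ → ProofOf (withConclusion S τ) S
  withConclusion-proof (Γ ⇒ Δ) vτ S∈τ =
    (inj₂ (_ , struct (E.cut Γ Δ e0) , there (here refl) ∷ here refl ∷ []) ,
     inj₂ (_ , struct (E.weakL Γ Δ e0) , there S∈τ ∷ []) ,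
     inj₂ (_ , struct (E.zeroR Γ Δ) , S∈τ ∷ []) , vτ) , refl

  withConclusion-size : ∀ {τ} S → size S + 1 ≤ B → eproofSize (withConclusion S τ) ≤ 3 * B + eproofSize τ
  withConclusion-size {τ} (Γ ⇒ Δ) S+1≤B = begin
    size (Γ ⇒ Δ) + (size ((Γ ++ [ e0 ]) ⇒ Δ) + (size (Γ ⇒ (Δ ++ [ e0 ])) + eproofSize τ))
      ≤⟨ +-mono-≤ (≤-trans (m≤m+n (size (Γ ⇒ Δ)) 1) S+1≤B)
                  (+-mono-≤ (≤-trans (≤-reflexive (size-++ˡ Γ Δ [ e0 ])) S+1≤B)
                            (+-monoˡ-≤ (eproofSize τ) (≤-trans (≤-reflexive (size-++ʳ Γ Δ [ e0 ])) S+1≤B))) ⟩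
    B + (B + (B + eproofSize τ))
      ≡⟨ solve 2 (λ b e → b :+ (b :+ (b :+ e)) := con 3 :* b :+ e) refl B (eproofSize τ) ⟩
    3 * B + eproofSize τ ∎
    where open ≤-Reasoning


negSeq : Seq CF → Sq
negSeq (Γ ⇒ Δ) = negList Δ ⇒ negList Γ

negSeq-++ˡ : ∀ Γ W Δ → negSeq ((Γ ++ W) ⇒ Δ) ≡ (negList Δ ⇒ (negList Γ ++ negList W))
negSeq-++ˡ Γ W Δ = cong (negList Δ ⇒_) (map-++ neg Γ W)

negSeq-++ʳ : ∀ Γ Δ W → negSeq (Γ ⇒ (Δ ++ W)) ≡ ((negList Δ ++ negList W) ⇒ negList Γ)
negSeq-++ʳ Γ Δ W = cong (_⇒ negList Γ) (map-++ neg Δ W)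

csizeSeq : Seq CF → ℕ
csizeSeq = seqSize csize

esize-neg : ∀ U → esize (neg U) ≡ csize U
esize-neg c0           = refl
esize-neg c1           = refl
esize-neg (cite U _ V) = cong₂ (λ u v → 2 + u + v) (esize-neg U) (esize-neg V)
esize-neg (U ∧ V)      = cong₂ (λ u v → 1 + u + v) (esize-neg U) (esize-neg V)
esize-neg (cext _)     = refl

∑size-negList : ∀ Γ → ∑size (negList Γ) ≡ sum (map csize Γ)
∑size-negList []      = refl
∑size-negList (U ∷ Γ) = cong₂ _+_ (esize-neg U) (∑size-negList Γ)

size-negSeq : ∀ t → size (negSeq t) ≡ csizeSeq t
size-negSeq (Γ ⇒ Δ) =
  cong suc (trans (cong₂ _+_ (∑size-negList Δ) (∑size-negList Γ)) (+-comm (sum (map csize Δ)) (sum (map csize Γ))))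

negAxiom-∈ : ∀ {i U} k ax → (i , U) ∈ indexedFrom k ax → (i , neg U) ∈ indexedFrom k (map neg ax)
negAxiom-∈ k (_ ∷ ax) (here refl) = here refl
negAxiom-∈ k (_ ∷ ax) (there m)   = there (negAxiom-∈ (suc k) ax m)

-- Every co-LNDT rule but p-left and p-right is, after negation, an LNDT rule.
data Dual : List (Seq CF) → Seq CF → Set where
  dual : ∀ {ps s ps' s'} → ERule ps' s' → s' ≡ negSeq s → All (_∈ map negSeq ps) ps' → Dual ps s
  ifL  : ∀ Γ Δ U p V →
         Dual (((Γ ++ [ U ]) ⇒ (Δ ++ [ cvar p ])) ∷ ((Γ ++ cvar p ∷ V ∷ []) ⇒ Δ) ∷ [])
              ((Γ ++ [ cite U p V ]) ⇒ Δ)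
  ifR  : ∀ Γ Δ U p V →
         Dual ((Γ ⇒ (Δ ++ U ∷ cvar p ∷ [])) ∷ ((Γ ++ [ cvar p ]) ⇒ (Δ ++ [ V ])) ∷ [])
              (Γ ⇒ (Δ ++ [ cite U p V ]))

dualOf : ∀ {ps s} → CRule ps s → Dual ps s
dualOf (struct (C.identity U)) = dual (struct (E.identity (neg U))) refl []
dualOf (struct (C.cut Γ Δ U)) =
  dual (struct (E.cut (negList Δ) (negList Γ) (neg U))) refl
       (there (here (sym (negSeq-++ˡ Γ [ U ] Δ))) ∷ here (sym (negSeq-++ʳ Γ Δ [ U ])) ∷ [])
dualOf (struct (C.exchL Γ Γ' Δ U V)) =
  dual (struct (E.exchR (negList Δ) (negList Γ) (negList Γ') (neg U) (neg V)))
       (sym (negSeq-++ˡ Γ (V ∷ U ∷ Γ') Δ)) (here (sym (negSeq-++ˡ Γ (U ∷ V ∷ Γ') Δ)) ∷ [])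
dualOf (struct (C.exchR Γ Δ Δ' U V)) =
  dual (struct (E.exchL (negList Δ) (negList Δ') (negList Γ) (neg U) (neg V)))
       (sym (negSeq-++ʳ Γ Δ (V ∷ U ∷ Δ'))) (here (sym (negSeq-++ʳ Γ Δ (U ∷ V ∷ Δ'))) ∷ [])
dualOf (struct (C.weakL Γ Δ U)) =
  dual (struct (E.weakR (negList Δ) (negList Γ) (neg U))) (sym (negSeq-++ˡ Γ [ U ] Δ)) (here refl ∷ [])
dualOf (struct (C.weakR Γ Δ U)) =
  dual (struct (E.weakL (negList Δ) (negList Γ) (neg U))) (sym (negSeq-++ʳ Γ Δ [ U ])) (here refl ∷ [])
dualOf (struct (C.contrL Γ Δ U)) =
  dual (struct (E.contrR (negList Δ) (negList Γ) (neg U)))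
       (sym (negSeq-++ˡ Γ [ U ] Δ)) (here (sym (negSeq-++ˡ Γ (U ∷ U ∷ []) Δ)) ∷ [])
dualOf (struct (C.contrR Γ Δ U)) =
  dual (struct (E.contrL (negList Δ) (negList Γ) (neg U)))
       (sym (negSeq-++ʳ Γ Δ [ U ])) (here (sym (negSeq-++ʳ Γ Δ (U ∷ U ∷ []))) ∷ [])
dualOf (struct C.zeroL) = dual (struct E.oneR) refl []
dualOf (struct (C.oneL Γ Δ)) =
  dual (struct (E.zeroR (negList Δ) (negList Γ))) (sym (negSeq-++ˡ Γ [ c1 ] Δ)) (here refl ∷ [])
dualOf (struct (C.zeroR Γ Δ)) =
  dual (struct (E.oneL (negList Δ) (negList Γ))) (sym (negSeq-++ʳ Γ Δ [ c0 ])) (here refl ∷ [])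
dualOf (struct C.oneR) = dual (struct E.zeroL) refl []
dualOf (struct (C.pL Γ Δ U p V)) = ifL Γ Δ U p V
dualOf (struct (C.pR Γ Δ U p V)) = ifR Γ Δ U p V
dualOf (andL Γ Δ U V) =
  dual (orR (negList Δ) (negList Γ) (neg U) (neg V))
       (sym (negSeq-++ˡ Γ [ U ∧ V ] Δ)) (here (sym (negSeq-++ˡ Γ (U ∷ V ∷ []) Δ)) ∷ [])
dualOf (andR Γ Δ U V) =
  dual (orL (negList Δ) (negList Γ) (neg U) (neg V))
       (sym (negSeq-++ʳ Γ Δ [ U ∧ V ]))
       (here (sym (negSeq-++ʳ Γ Δ [ U ])) ∷ there (here (sym (negSeq-++ʳ Γ Δ [ V ]))) ∷ [])

module Translation (ax : CAxioms) (N : ℕ) where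

  B : ℕ
  B = 20 + N

  open Extensions (negAxioms ax) B public
  module Co = C.Proofs CRule (CHyp ax)

  20≤B : 20 ≤ B
  20≤B = m≤m+n 20 N

  negSeq-fits : ∀ t → csizeSeq t ≤ N → size (negSeq t) ≤ B
  negSeq-fits t t≤N = subst (_≤ B) (sym (size-negSeq t)) (≤-trans t≤N (m≤n+m N 20))

  negSeq-room : ∀ t → csizeSeq t ≤ N → size (negSeq t) + 8 ≤ B
  negSeq-room t t≤N =
    subst (λ n → n + 8 ≤ B) (sym (size-negSeq t))
      (≤-trans (+-monoˡ-≤ 8 t≤N) (≤-trans (≤-reflexive (+-comm N 8)) (+-monoˡ-≤ N (≤ᵇ⇒≤ 8 20 tt))))

  ∈-negSeq : ∀ {π E t} → map negSeq π ⊆ E → t ∈ π → negSeq t ∈ E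
  ∈-negSeq π̄⊆E t∈π = π̄⊆E (∈-map⁺ negSeq t∈π)

  translateIfL : ∀ {E} Γ Δ U p V →
    negSeq ((Γ ++ [ U ]) ⇒ (Δ ++ [ cvar p ])) ∈ E → negSeq ((Γ ++ cvar p ∷ V ∷ []) ⇒ Δ) ∈ E →
    size (negSeq ((Γ ++ [ U ]) ⇒ (Δ ++ [ cvar p ]))) + 8 ≤ B →
    size (negSeq ((Γ ++ cvar p ∷ V ∷ []) ⇒ Δ)) + 8 ≤ B →
    size (negSeq ((Γ ++ [ cite U p V ]) ⇒ Δ)) ≤ B → Derives E ifCost (negSeq ((Γ ++ [ cite U p V ]) ⇒ Δ))
  translateIfL Γ Δ U p V
    rewrite map-++ neg Γ [ U ] | map-++ neg Δ [ cvar p ] | map-++ neg Γ (cvar p ∷ V ∷ [])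
          | map-++ neg Γ [ cite U p V ]
    = ifʳ 20≤B (negList Δ) (negList Γ) (neg U) p (neg V)

  translateIfR : ∀ {E} Γ Δ U p V →
    negSeq (Γ ⇒ (Δ ++ U ∷ cvar p ∷ [])) ∈ E → negSeq ((Γ ++ [ cvar p ]) ⇒ (Δ ++ [ V ])) ∈ E →
    size (negSeq (Γ ⇒ (Δ ++ U ∷ cvar p ∷ []))) + 8 ≤ B →
    size (negSeq ((Γ ++ [ cvar p ]) ⇒ (Δ ++ [ V ]))) + 8 ≤ B →
    size (negSeq (Γ ⇒ (Δ ++ [ cite U p V ]))) ≤ B → Derives E ifCost (negSeq (Γ ⇒ (Δ ++ [ cite U p V ])))
  translateIfR Γ Δ U p V
    rewrite map-++ neg Δ (U ∷ cvar p ∷ []) | map-++ neg Δ [ V ] | map-++ neg Γ [ cvar p ]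
          | map-++ neg Δ [ cite U p V ]
    = ifˡ 20≤B (negList Δ) (negList Γ) (neg U) p (neg V)

  translateLine : ∀ {π E s} → Co.Justified π s → map negSeq π ⊆ E →
                  All (λ t → size (negSeq t) + 8 ≤ B) π → size (negSeq s) ≤ B → Derives E ifCost (negSeq s)
  translateLine (inj₁ (hypL i)) _ _ fits = relax (s≤s z≤n) (assume (hypR (negAxiom-∈ 0 ax i)) fits)
  translateLine (inj₁ (hypR i)) _ _ fits = relax (s≤s z≤n) (assume (hypL (negAxiom-∈ 0 ax i)) fits)
  translateLine (inj₂ (_ , r , prems)) π̄⊆E rooms fits with dualOf r | prems
  ... | dual r' refl prems' | prems =
    relax (s≤s z≤n) (infer r' fits (All.map (λ m → π̄⊆E (⊆-map⁺ negSeq (All.lookup prems) m)) prems'))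
  ... | ifL Γ Δ U p V | m₁ ∷ m₂ ∷ [] =
    translateIfL Γ Δ U p V (∈-negSeq π̄⊆E m₁) (∈-negSeq π̄⊆E m₂) (All.lookup rooms m₁) (All.lookup rooms m₂) fits
  ... | ifR Γ Δ U p V | m₁ ∷ m₂ ∷ [] =
    translateIfR Γ Δ U p V (∈-negSeq π̄⊆E m₁) (∈-negSeq π̄⊆E m₂) (All.lookup rooms m₁) (All.lookup rooms m₂) fits

  translate : ∀ {π} → Co.Valid π → All (λ t → csizeSeq t ≤ N) π →
              Extension [] (length π * ifCost) (map negSeq π ⊆_)
  translate {[]}    _       []              = pure (λ ())
  translate {s ∷ π} (j , v) (s≤N ∷ bounded) =
    relax (≤-reflexive (solve 2 (λ a l → a :+ (l :+ con 0) := l :+ a) refl (length π * ifCost) ifCost))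
      (translate v bounded >>= λ _ π̄⊆ →
       translateLine j π̄⊆ (All.map (λ {t} → negSeq-room t) bounded) (negSeq-fits s s≤N) >>= λ ⊆′ s̄∈ →
       pure (∈-∷⁺ʳ s̄∈ (λ m → ⊆′ (π̄⊆ m))))

lines≤cproofSize : ∀ π → All (λ t → csizeSeq t ≤ cproofSize π) π
lines≤cproofSize []      = []
lines≤cproofSize (s ∷ π) =
  m≤m+n _ _ ∷ All.map (λ t≤ → ≤-trans t≤ (m≤n+m _ (csizeSeq s))) (lines≤cproofSize π)

length≤cproofSize : ∀ π → length π ≤ cproofSize π
length≤cproofSize []      = z≤n
length≤cproofSize (s ∷ π) = +-mono-≤ (s≤s z≤n) (length≤cproofSize π)

cubic-bound : ∀ n → 1 ≤ n → 3 * (20 + n) + n * (22 + 8 * (20 + n)) * (20 + n) ≤ 2027 * n ^ 3 + 2027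
cubic-bound (suc m) _ =
  ≤-trans (m≤m+n _ (2019 * m ^ 3 + 5715 * m ^ 2 + 1730 * m + 1)) (≤-reflexive (solve 1 (λ m →
    let n = con 1 :+ m ; b = con 20 :+ n in
    con 3 :* b :+ n :* (con 22 :+ con 8 :* b) :* b :+ (con 2019 :* m :^ 3 :+ con 5715 :* m :^ 2 :+ con 1730 :* m :+ con 1)
      := con 2027 :* n :^ 3 :+ con 2027) refl m))

-- The translation never looks inside the extension axioms.
lemma7p6 : Σ ℕ λ c → Σ ℕ λ k →
    (ax : CAxioms) → WellFormedC ax →
    (Γ Δ : List CF) (π : List (Seq CF)) → CProofOf ax π (Γ ⇒ Δ) →
    Σ (List (Seq EF)) λ π̄ →
      EProofOf (negAxioms ax) π̄ (negList Δ ⇒ negList Γ) ×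
      eproofSize π̄ ≤ c * cproofSize π ^ k + c
lemma7p6 = 2027 , 3 , negateProof
  where
    negateProof : (ax : CAxioms) → WellFormedC ax →
                  (Γ Δ : List CF) (π : List (Seq CF)) → CProofOf ax π (Γ ⇒ Δ) →
                  Σ (List (Seq EF)) λ π̄ →
                    EProofOf (negAxioms ax) π̄ (negList Δ ⇒ negList Γ) ×
                    eproofSize π̄ ≤ 2027 * cproofSize π ^ 3 + 2027
    negateProof ax _ Γ Δ (s ∷ π) (π-valid , refl) =
      withConclusion (negSeq s) τ , withConclusion-proof (negSeq s) τ-valid (s̄∈τ (here refl)) , bound
      where
        N = cproofSize (s ∷ π)
        open Translation ax N
        open Extension (translate π-valid (lines≤cproofSize (s ∷ π))) renaming (goal to s̄∈τ)
        τ = new ++ []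
        τ-valid : Valid τ
        τ-valid = ValidOver⇒Valid new valid tt
        bound : eproofSize (withConclusion (negSeq s) τ) ≤ 2027 * N ^ 3 + 2027
        bound = begin
          eproofSize (withConclusion (negSeq s) τ)
            ≤⟨ withConclusion-size {τ} (negSeq s)
                 (≤-trans (+-monoʳ-≤ (size (negSeq s)) (≤ᵇ⇒≤ 1 8 tt)) (negSeq-room s (m≤m+n _ _))) ⟩
          3 * B + eproofSize τ
            ≡⟨ cong (λ β → 3 * B + eproofSize β) (++-identityʳ new) ⟩
          3 * B + eproofSize new
            ≤⟨ +-monoʳ-≤ (3 * B) (≤-trans cost (*-monoˡ-≤ B (*-monoˡ-≤ ifCost (length≤cproofSize (s ∷ π))))) ⟩
          3 * B + N * ifCost * B
            ≤⟨ cubic-bound N (s≤s z≤n) ⟩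
          2027 * N ^ 3 + 2027 ∎
          where open ≤-Reasoning
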